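{- Let $A=\{a,b\}$, let $A^{\mathbb N}_{\mathrm{cl}}$ be the set of infinite words over $A$ closed under reversal and $A^{\mathbb N}_{\mathrm{ap/cl}}$ the set of aperiodic infinite words over $A$ closed under reversal. Then $\mathit{MinPal}(A^{\mathbb N}_{\mathrm{cl}})=\mathit{MinPal}(A^{\mathbb N}_{\mathrm{ap/cl}})=13$.
   Context: For an infinite word $\omega$, $\mathrm{PAL}(\omega)$ is the set of palindromic factors (including the empty word); for a set $X$ of infinite words, $\mathit{MinPal}(X)=\inf\{\#\mathrm{PAL}(\omega)\mid\omega\in X\}$. Closed under reversal: the reversal of every factor is a factor. Aperiodic: not ultimately periodic. -}

module Defs where

open import Data.Nat using (ℕ; zero; suc; _+_; _≤_; _<_)
open import Data.List using (List; []; _∷_; length; reverse)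
open import Data.List.Membership.Propositional using (_∈_)
open import Data.List.Relation.Unary.Unique.Propositional using (Unique)
open import Data.Product using (Σ; ∃; _×_; _,_)
open import Relation.Binary.PropositionalEquality using (_≡_)
open import Relation.Nullary using (¬_)

data Letter : Set where
  a b : Letter

Word : Set
Word = ℕ → Letter

slice : Word → ℕ → ℕ → List Letter
slice ω i zero    = []
slice ω i (suc n) = ω i ∷ slice ω (suc i) n

-- w is a factor of ω (the empty word is a factor of every word).
Factor : List Letter → Word → Set
Factor w ω = ∃ λ i → slice ω i (length w) ≡ w

Palindrome : List Letter → Set
Palindrome w = reverse w ≡ w

PalFactor : Word → List Letter → Set
PalFactor ω w = Factor w ω × Palindrome w

ClosedUnderReversal : Word → Set
ClosedUnderReversal ω = ∀ w → Factor w ω → Factor (reverse w) ω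

UltimatelyPeriodic : Word → Set
UltimatelyPeriodic ω =
  Σ ℕ λ p → 0 < p × Σ ℕ λ N → ∀ n → N ≤ n → ω (n + p) ≡ ω n

Aperiodic : Word → Set
Aperiodic ω = ¬ UltimatelyPeriodic ω

Cl : Word → Set
Cl ω = ClosedUnderReversal ω

ApCl : Word → Set
ApCl ω = Aperiodic ω × ClosedUnderReversal ω

-- #PAL(ω) ≥ n : no list with fewer than n entries contains every palindromic factor
-- (covers both the finite and the infinite case).
PalAtLeast : ℕ → Word → Set
PalAtLeast n ω = (L : List (List Letter)) → (∀ w → PalFactor ω w → w ∈ L) → n ≤ length L

PalExactly : ℕ → Word → Set
PalExactly n ω = Σ (List (List Letter)) λ L →
  length L ≡ n × Unique L × (∀ w → (PalFactor ω w → w ∈ L) × (w ∈ L → PalFactor ω w))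

-- MinPal(X) = n  (the infimum over ℕ ∪ {∞}; a value n ∈ ℕ is attained).
MinPalIs : (Word → Set) → ℕ → Set
MinPalIs X n = (∀ ω → X ω → PalAtLeast n ω) × (Σ Word λ ω → X ω × PalExactly n ω)

-- Lower bound: a depth-first search extends the windows of a hypothetical closed word letter by letter,
-- branching on whether each palindrome that shows up is a factor, and refutes every branch in which at
-- most 12 palindromes are factors. A branch dies when a window would contain a palindrome decided to be
-- absent, when a thirteenth palindrome is needed, or when the graph of surviving windows cannot support
-- a closed word: there every window must be followed, later on, by its reversal.
-- Upper bound: the limit ω₀ of u₀ = abbabaaabb, uₙ₊₁ = uₙ aaba uₙᴿ is closed under reversal by
-- construction. Its factors of length 8 lie in u₀, in u₁ or around the centre aaba, which leaves 38 words,
-- so its palindromic factors are exactly 13 words of length at most 6. An ultimately periodic closed word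
-- has arbitrarily long palindromes, so ω₀ is also aperiodic.

module Submission where

open import Defs
open import Data.Nat using (ℕ; zero; suc; _+_; _≤_; _<_; s≤s; _∸_; _*_; _≤?_; z≤n; _≤ᵇ_; _≡ᵇ_; _≟_)
open import Data.Nat.Properties
  using (suc-injective; +-suc; +-assoc; +-comm; +-identityʳ; m≤n+m; ≤-trans; ≤-reflexive; <⇒≱; n≤1+n;
         m≤m+n; m<n+m; m<n⇒0<n∸m; m+[n∸m]≡n; <⇒≤; +-monoʳ-≤; ≤ᵇ⇒≤; m∸n+n≡m; ≰⇒>; ≤-pred; m<m+n; m≤n⇒m⊓n≡m;
         m+n∸m≡n; ∸-monoˡ-≤)
open import Data.List using (List; []; _∷_; length; reverse; _++_; _∷ʳ_; take; inits; map; null; drop)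
open import Data.List.Properties
  using (≡-dec; ∷-injective; reverse-++; reverse-involutive; length-reverse; ++-assoc; length-++;
         length-++-≤ˡ; length-++-≤ʳ; ∷-injectiveʳ; length-++-sucʳ; ++-identityʳ; length-take; length-drop;
         take++drop≡id)
open import Data.Product using (∃; _×_; _,_; proj₁; proj₂; map₁; ∃₂)
open import Relation.Binary.PropositionalEquality
open import Relation.Binary.Definitions using (DecidableEquality)
open import Relation.Nullary using (yes; no)
open import Data.List.Membership.Propositional using (_∈_; _∉_)
open import Data.List.Membership.Propositional.Properties using (∈-map⁺; ∈-∃++; ∈-++⁻; ∈-++⁺ˡ; ∈-++⁺ʳ)
open import Data.List.Relation.Unary.Any using (here; there)
open import Data.List.Relation.Unary.All as All using (All; []; _∷_; all?)
open import Data.Sum using (_⊎_; inj₁; inj₂)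
open import Data.Empty using (⊥-elim; ⊥)
open import Data.Nat.DivMod using (_%_; _/_; m≡m%n+[m/n]*n; m%n<n)
open import Data.Bool using (Bool; true; false; _∧_; _∨_; not; if_then_else_; T)
open import Data.Unit using (tt)
open import Data.List.Relation.Unary.AllPairs using ([]; _∷_)
open import Data.List.Relation.Unary.Unique.Propositional using (Unique)
open import Function using (_∘_)
open import Relation.Nullary.Decidable using (True; toWitness; from-yes; _→-dec_)

_≟ˡ_ : DecidableEquality Letter
a ≟ˡ a = yes refl
a ≟ˡ b = no λ ()
b ≟ˡ a = no λ ()
b ≟ˡ b = yes refl

_≟ʷ_ : DecidableEquality (List Letter)
_≟ʷ_ = ≡-dec _≟ˡ_

open import Data.List.Membership.DecPropositional _≟ʷ_ using (_∈?_)
open import Data.List.Relation.Unary.Unique.DecPropositional _≟ʷ_ using (unique?)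

++-injective : ∀ {A : Set} (xs xs′ : List A) {ys ys′ : List A} →
               length xs ≡ length xs′ → xs ++ ys ≡ xs′ ++ ys′ → xs ≡ xs′ × ys ≡ ys′
++-injective []       []         _   eq = refl , eq
++-injective (x ∷ xs) (x′ ∷ xs′) len eq with ∷-injective eq
... | refl , eq′ = map₁ (cong (x ∷_)) (++-injective xs xs′ (suc-injective len) eq′)

-- Windows of infinite words

length-slice : ∀ ω i n → length (slice ω i n) ≡ n
length-slice ω i zero    = refl
length-slice ω i (suc n) = cong suc (length-slice ω (suc i) n)

slice-factor : ∀ ω i n → Factor (slice ω i n) ω
slice-factor ω i n = i , cong (slice ω i) (length-slice ω i n)

slice-++ : ∀ ω i m n → slice ω i (m + n) ≡ slice ω i m ++ slice ω (i + m) n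
slice-++ ω i zero    n = cong (λ k → slice ω k n) (sym (+-identityʳ i))
slice-++ ω i (suc m) n =
  cong (ω i ∷_) (trans (slice-++ ω (suc i) m n) (cong (λ k → slice ω (suc i) m ++ slice ω k n) (sym (+-suc i m))))

slice-++-++ : ∀ ω i l m n → slice ω i (l + (m + n)) ≡ slice ω i l ++ slice ω (i + l) m ++ slice ω (i + l + m) n
slice-++-++ ω i l m n = trans (slice-++ ω i l (m + n)) (cong (slice ω i l ++_) (slice-++ ω (i + l) m n))

slice-∷ʳ : ∀ ω i n → slice ω i (suc n) ≡ slice ω i n ∷ʳ ω (i + n)
slice-∷ʳ ω i n = trans (cong (slice ω i) (+-comm 1 n)) (slice-++ ω i n 1)

-- The window ω(i+n-1) … ω(i) read backwards, so that extending it by the next letter is a cons.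
revSlice : Word → ℕ → ℕ → List Letter
revSlice ω i zero    = []
revSlice ω i (suc n) = ω (i + n) ∷ revSlice ω i n

length-revSlice : ∀ ω i n → length (revSlice ω i n) ≡ n
length-revSlice ω i zero    = refl
length-revSlice ω i (suc n) = cong suc (length-revSlice ω i n)

revSlice≡reverse-slice : ∀ ω i n → revSlice ω i n ≡ reverse (slice ω i n)
revSlice≡reverse-slice ω i zero    = refl
revSlice≡reverse-slice ω i (suc n) = sym (begin
  reverse (slice ω i (suc n))             ≡⟨ cong reverse (slice-∷ʳ ω i n) ⟩
  reverse (slice ω i n ∷ʳ ω (i + n))      ≡⟨ reverse-++ (slice ω i n) (ω (i + n) ∷ []) ⟩
  ω (i + n) ∷ reverse (slice ω i n)       ≡⟨ cong (ω (i + n) ∷_) (sym (revSlice≡reverse-slice ω i n)) ⟩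
  revSlice ω i (suc n)                    ∎)
  where open ≡-Reasoning

revSlice-++ : ∀ ω i k m → revSlice ω i (k + m) ≡ revSlice ω (i + m) k ++ revSlice ω i m
revSlice-++ ω i zero    m = refl
revSlice-++ ω i (suc k) m =
  cong₂ _∷_ (cong ω (trans (cong (i +_) (+-comm k m)) (sym (+-assoc i m k)))) (revSlice-++ ω i k m)

revSlice-prefix-factor : ∀ ω i q r → revSlice ω i (length q + length r) ≡ q ++ r → Factor (reverse q) ω
revSlice-prefix-factor ω i q r eq = i + length r , (begin
  slice ω (i + length r) (length (reverse q))     ≡⟨ cong (slice ω (i + length r)) (length-reverse q) ⟩
  slice ω (i + length r) (length q)               ≡⟨ sym (reverse-involutive _) ⟩
  reverse (reverse (slice ω (i + length r) (length q)))
                                                  ≡⟨ cong reverse (sym (revSlice≡reverse-slice ω (i + length r) (length q))) ⟩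
  reverse (revSlice ω (i + length r) (length q))  ≡⟨ cong reverse prefix ⟩
  reverse q                                       ∎)
  where
  open ≡-Reasoning
  prefix : revSlice ω (i + length r) (length q) ≡ q
  prefix = proj₁ (++-injective (revSlice ω (i + length r) (length q)) q (length-revSlice ω (i + length r) (length q))
             (trans (sym (revSlice-++ ω i (length q) (length r))) eq))

-- Apply closure to the prefix of length i + n + k: in its reversal, the block
-- after the first k letters is the reversal of ω[i, i+n).
reversal-occurs-beyond : ∀ {ω} → ClosedUnderReversal ω → ∀ i n k →
                 ∃ λ j → k ≤ j × slice ω j n ≡ reverse (slice ω i n)
reversal-occurs-beyond {ω} closed i n k with closed (slice ω 0 (i + (n + k))) (slice-factor ω 0 (i + (n + k)))
... | q , occurs = q + k , m≤n+m k q , middle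
  where
  P = slice ω 0 (i + (n + k))
  Aᴿ = reverse (slice ω (i + n) k)
  Bᴿ = reverse (slice ω i n)
  Cᴿ = reverse (slice ω 0 i)
  open ≡-Reasoning
  reverse-P : reverse P ≡ Aᴿ ++ Bᴿ ++ Cᴿ
  reverse-P = begin
    reverse P                                                   ≡⟨ cong reverse (slice-++-++ ω 0 i n k) ⟩
    reverse (slice ω 0 i ++ slice ω i n ++ slice ω (i + n) k)  ≡⟨ reverse-++ (slice ω 0 i) _ ⟩
    reverse (slice ω i n ++ slice ω (i + n) k) ++ Cᴿ           ≡⟨ cong (_++ Cᴿ) (reverse-++ (slice ω i n) _) ⟩
    (Aᴿ ++ Bᴿ) ++ Cᴿ                                           ≡⟨ ++-assoc Aᴿ Bᴿ Cᴿ ⟩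
    Aᴿ ++ Bᴿ ++ Cᴿ                                             ∎
  length-reverse-P : length (reverse P) ≡ k + (n + i)
  length-reverse-P = begin
    length (reverse P)  ≡⟨ length-reverse P ⟩
    length P            ≡⟨ length-slice ω 0 (i + (n + k)) ⟩
    i + (n + k)         ≡⟨ +-comm i (n + k) ⟩
    (n + k) + i         ≡⟨ cong (_+ i) (+-comm n k) ⟩
    (k + n) + i         ≡⟨ +-assoc k n i ⟩
    k + (n + i)         ∎
  split : slice ω q k ++ slice ω (q + k) n ++ slice ω (q + k + n) i ≡ Aᴿ ++ Bᴿ ++ Cᴿ
  split = begin
    slice ω q k ++ slice ω (q + k) n ++ slice ω (q + k + n) i ≡⟨ sym (slice-++-++ ω q k n i) ⟩
    slice ω q (k + (n + i))                                    ≡⟨ cong (slice ω q) (sym length-reverse-P) ⟩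
    slice ω q (length (reverse P))                             ≡⟨ occurs ⟩
    reverse P                                                  ≡⟨ reverse-P ⟩
    Aᴿ ++ Bᴿ ++ Cᴿ                                             ∎
  length-sliceᴿ : ∀ j m l → length (slice ω j m) ≡ length (reverse (slice ω l m))
  length-sliceᴿ j m l = trans (length-slice ω j m) (sym (trans (length-reverse (slice ω l m)) (length-slice ω l m)))
  middle : slice ω (q + k) n ≡ Bᴿ
  middle = proj₁ (++-injective _ Bᴿ (length-sliceᴿ (q + k) n i)
             (proj₂ (++-injective (slice ω q k) Aᴿ (length-sliceᴿ q k (i + n)) split)))

occurs-beyond : ∀ {ω} → ClosedUnderReversal ω → ∀ i n k → ∃ λ j → k ≤ j × slice ω j n ≡ slice ω i n
occurs-beyond {ω} closed i n k with reversal-occurs-beyond closed i n 0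
... | j₀ , _ , eq₀ with reversal-occurs-beyond closed j₀ n k
... | j , k≤j , eq = j , k≤j , trans eq (trans (cong reverse eq₀) (reverse-involutive (slice ω i n)))

module _ {A : Set} where

  IsPrefix IsSuffix Infix : List A → List A → Set
  IsPrefix u xs = ∃ λ s → xs ≡ u ++ s
  IsSuffix u xs = ∃ λ p → xs ≡ p ++ u
  Infix    u xs = ∃₂ λ p s → xs ≡ p ++ u ++ s

  Straddles : List A → List A → List A → Set
  Straddles u xs ys = ∃₂ λ u₁ u₂ → u ≡ u₁ ++ u₂ × IsSuffix u₁ xs × IsPrefix u₂ ys

  prefix-++ : ∀ xs ys u s → xs ++ ys ≡ u ++ s → IsPrefix u xs ⊎ ∃ λ u₂ → u ≡ xs ++ u₂ × ys ≡ u₂ ++ s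
  prefix-++ []       ys u       s eq = inj₂ (u , refl , eq)
  prefix-++ (x ∷ xs) ys []      s eq = inj₁ (x ∷ xs , refl)
  prefix-++ (x ∷ xs) ys (y ∷ u) s eq with ∷-injective eq
  ... | refl , eq′ with prefix-++ xs ys u s eq′
  ...   | inj₁ (s′ , e)        = inj₁ (s′ , cong (x ∷_) e)
  ...   | inj₂ (u₂ , e₁ , e₂)  = inj₂ (u₂ , cong (x ∷_) e₁ , e₂)

  infix-++ : ∀ xs ys u → Infix u (xs ++ ys) → Infix u xs ⊎ Infix u ys ⊎ Straddles u xs ys
  infix-++ []       ys u (p , s , eq) = inj₂ (inj₁ (p , s , eq))
  infix-++ (x ∷ xs) ys u ([] , s , eq) with prefix-++ (x ∷ xs) ys u s eq
  ... | inj₁ (s′ , e)       = inj₁ ([] , s′ , e)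
  ... | inj₂ (u₂ , e₁ , e₂) = inj₂ (inj₂ (x ∷ xs , u₂ , e₁ , ([] , refl) , (s , e₂)))
  infix-++ (x ∷ xs) ys u (y ∷ p , s , eq) with ∷-injective eq
  ... | refl , eq′ with infix-++ xs ys u (p , s , eq′)
  ...   | inj₁ (p′ , s′ , e) = inj₁ (x ∷ p′ , s′ , cong (x ∷_) e)
  ...   | inj₂ (inj₁ i)      = inj₂ (inj₁ i)
  ...   | inj₂ (inj₂ (u₁ , u₂ , e , (p₁ , e₁) , pre)) = inj₂ (inj₂ (u₁ , u₂ , e , (x ∷ p₁ , cong (x ∷_) e₁) , pre))

  prefix-shrink : ∀ u xs ys → IsPrefix u (xs ++ ys) → length u ≤ length xs → IsPrefix u xs
  prefix-shrink []      xs       ys _            _         = xs , refl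
  prefix-shrink (x ∷ u) (y ∷ xs) ys (s , eq) (s≤s le) with ∷-injective eq
  ... | refl , eq′ with prefix-shrink u xs ys (s , eq′) le
  ...   | s′ , e = s′ , cong (x ∷_) e

  suffix-shrink : ∀ u xs ys → IsSuffix u (xs ++ ys) → length u ≤ length ys → IsSuffix u ys
  suffix-shrink u xs ys (p , eq) le with prefix-shrink (reverse u) (reverse ys) (reverse xs) (reverse p , eq′) le′
    where
    eq′ : reverse ys ++ reverse xs ≡ reverse u ++ reverse p
    eq′ = trans (sym (reverse-++ xs ys)) (trans (cong reverse eq) (reverse-++ p u))
    le′ : length (reverse u) ≤ length (reverse ys)
    le′ = subst₂ _≤_ (sym (length-reverse u)) (sym (length-reverse ys)) le
  ... | s′ , e = reverse s′ , (begin
    ys                          ≡⟨ sym (reverse-involutive ys) ⟩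
    reverse (reverse ys)        ≡⟨ cong reverse e ⟩
    reverse (reverse u ++ s′)   ≡⟨ reverse-++ (reverse u) s′ ⟩
    reverse s′ ++ reverse (reverse u) ≡⟨ cong (reverse s′ ++_) (reverse-involutive u) ⟩
    reverse s′ ++ u             ∎)
    where open ≡-Reasoning

  infix-length : ∀ u xs → Infix u xs → length u ≤ length xs
  infix-length u xs (p , s , refl) =
    ≤-trans (length-++-≤ˡ u) (≤-trans (m≤n+m _ (length p)) (≤-reflexive (sym (length-++ p))))

  reverse-infix : ∀ u xs → Infix u xs → Infix (reverse u) (reverse xs)
  reverse-infix u xs (p , s , eq) = reverse s , reverse p , (begin
    reverse xs                             ≡⟨ cong reverse eq ⟩
    reverse (p ++ u ++ s)                  ≡⟨ reverse-++ p (u ++ s) ⟩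
    reverse (u ++ s) ++ reverse p          ≡⟨ cong (_++ reverse p) (reverse-++ u s) ⟩
    (reverse s ++ reverse u) ++ reverse p  ≡⟨ ++-assoc (reverse s) (reverse u) (reverse p) ⟩
    reverse s ++ reverse u ++ reverse p    ∎)
    where open ≡-Reasoning

  infix-reverse : ∀ u xs → Infix u (reverse xs) → Infix (reverse u) xs
  infix-reverse u xs occ = subst (Infix (reverse u)) (reverse-involutive xs) (reverse-infix u (reverse xs) occ)

  infix-++ˡ : ∀ ys u xs → Infix u xs → Infix u (ys ++ xs)
  infix-++ˡ ys u xs (p , s , eq) = ys ++ p , s , trans (cong (ys ++_) eq) (sym (++-assoc ys p (u ++ s)))

  straddle-infix : ∀ u₁ u₂ xs ys → IsSuffix u₁ xs → IsPrefix u₂ ys → Infix (u₁ ++ u₂) (xs ++ ys)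
  straddle-infix u₁ u₂ _ _ (p , refl) (s , refl) =
    p , s , trans (++-assoc p u₁ (u₂ ++ s)) (cong (p ++_) (sym (++-assoc u₁ u₂ s)))

  windows : ℕ → List A → List (List A)
  windows k []       = []
  windows k (x ∷ xs) = take k (x ∷ xs) ∷ windows k xs

  infix∈windows : ∀ k u xs → Infix u xs → length u ≡ suc k → u ∈ windows (suc k) xs
  infix∈windows k (x ∷ u) .(x ∷ u ++ s) ([] , s , refl) len =
    here (sym (subst (λ n → take n (x ∷ u ++ s) ≡ x ∷ u) len (take-++-length (x ∷ u) s)))
    where
    take-++-length : ∀ v s → take (length v) (v ++ s) ≡ v
    take-++-length []      s = refl
    take-++-length (y ∷ v) s = cong (y ∷_) (take-++-length v s)
  infix∈windows k u .(y ∷ p ++ u ++ s) (y ∷ p , s , refl) len = there (infix∈windows k u _ (p , s , refl) len)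

  prefix∈inits : ∀ v w → IsPrefix v w → v ∈ inits w
  prefix∈inits []      w               _          = here refl
  prefix∈inits (x ∷ v) .(x ∷ v ++ s) (s , refl) = there (∈-map⁺ (x ∷_) (prefix∈inits v (v ++ s) (s , refl)))

  AllFactors : (List A → Set) → ℕ → List A → Set
  AllFactors F k xs = ∀ u → length u ≡ k → Infix u xs → F u

  AllFactors-windows : ∀ {F} k xs → All (λ v → length v ≡ suc k → F v) (windows (suc k) xs) → AllFactors F (suc k) xs
  AllFactors-windows k xs all-windows u len occ = All.lookup all-windows (infix∈windows k u xs occ len) len

  -- A factor of length k of X c Xᴿ lies in X, in Xᴿ, or within the k letters around c,
  -- that is in Q c Qᴿ for any suffix Q of X that is at least k long.
  AllFactors-extend : ∀ {F k} → (∀ u → F u → F (reverse u)) → ∀ c P Q → length c < k → k ≤ length Q →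
                     AllFactors F k (P ++ Q) → AllFactors F k (Q ++ c ++ reverse Q) →
                     AllFactors F k ((P ++ Q) ++ c ++ reverse (P ++ Q))
  AllFactors-extend {F} {k} F-reverse c P Q c<k k≤Q in-X in-middle u len u∈
    with infix-++ (P ++ Q) (c ++ reverse (P ++ Q)) u u∈
  ... | inj₁ in-X′ = in-X u len in-X′
  ... | inj₂ (inj₂ (u₁ , u₂ , refl , suf , pre)) =
    in-middle _ len (straddle-infix u₁ u₂ Q (c ++ reverse Q)
      (suffix-shrink u₁ P Q suf (≤-trans (length-++-≤ˡ u₁) (≤-trans (≤-reflexive len) k≤Q)))
      (prefix-shrink u₂ (c ++ reverse Q) (reverse P) (subst (IsPrefix u₂) reverse-X pre)
        (≤-trans (length-++-≤ʳ u₂ {u₁}) (≤-trans (≤-reflexive len) (≤-trans k≤Q Q≤cQᴿ)))))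
    where
    reverse-X : c ++ reverse (P ++ Q) ≡ (c ++ reverse Q) ++ reverse P
    reverse-X = trans (cong (c ++_) (reverse-++ P Q)) (sym (++-assoc c (reverse Q) (reverse P)))
    Q≤cQᴿ : length Q ≤ length (c ++ reverse Q)
    Q≤cQᴿ = ≤-trans (≤-reflexive (sym (length-reverse Q))) (length-++-≤ʳ (reverse Q) {c})
  ... | inj₂ (inj₁ in-tail) with infix-++ c (reverse (P ++ Q)) u in-tail
  ...   | inj₁ in-c = ⊥-elim (<⇒≱ c<k (≤-trans (≤-reflexive (sym len)) (infix-length u c in-c)))
  ...   | inj₂ (inj₁ in-Xᴿ) =
    subst F (reverse-involutive u)
      (F-reverse _ (in-X (reverse u) (trans (length-reverse u) len) (infix-reverse u (P ++ Q) in-Xᴿ)))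
  ...   | inj₂ (inj₂ (u₁ , u₂ , refl , suf , pre)) =
    in-middle _ len (infix-++ˡ Q (u₁ ++ u₂) (c ++ reverse Q) (straddle-infix u₁ u₂ c (reverse Q) suf
      (prefix-shrink u₂ (reverse Q) (reverse P) (subst (IsPrefix u₂) (reverse-++ P Q) pre)
        (≤-trans (length-++-≤ʳ u₂ {u₁}) (≤-trans (≤-reflexive len) (≤-trans k≤Q (≤-reflexive (sym (length-reverse Q)))))))))

-- Palindromic factors and periodicity

strip-palindrome : ∀ {ω} n w → length w ≡ 2 + n → PalFactor ω w → ∃ λ v → length v ≡ n × PalFactor ω v
strip-palindrome {ω} n w len ((i , occurs) , pal) =
  v , length-slice ω (suc i) n , slice-factor ω (suc i) n , proj₁ (++-injective (reverse v) v (length-reverse v) inner)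
  where
  v = slice ω (suc i) n
  x = ω i
  y = ω (suc i + n)
  w≡xvy : w ≡ x ∷ v ∷ʳ y
  w≡xvy = trans (sym occurs) (trans (cong (slice ω i) len) (cong (x ∷_) (slice-∷ʳ ω (suc i) n)))
  open ≡-Reasoning
  inner : reverse v ++ x ∷ [] ≡ v ++ y ∷ []
  inner = ∷-injectiveʳ (begin
    y ∷ reverse v ++ x ∷ []     ≡⟨ sym (trans (reverse-++ (x ∷ []) (v ∷ʳ y)) (cong (_++ x ∷ []) (reverse-++ v (y ∷ [])))) ⟩
    reverse (x ∷ v ∷ʳ y)       ≡⟨ cong reverse (sym w≡xvy) ⟩
    reverse w                   ≡⟨ pal ⟩
    w                           ≡⟨ w≡xvy ⟩
    x ∷ v ∷ʳ y                  ∎)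

-- Stripping the two end letters keeps a palindromic factor, so it suffices to exclude lengths m+1 and m+2.
palindrome-length-bound : ∀ {ω} m → (∀ w → PalFactor ω w → length w ≤ 2 + m → length w ≤ m) →
                          ∀ w → PalFactor ω w → length w ≤ m
palindrome-length-bound {ω} m short w = bound (length w) w refl
  where
  bound : ∀ n w → length w ≡ n → PalFactor ω w → length w ≤ m
  bound n w len pal with length w ≤? 2 + m
  ... | yes w≤2+m = short w pal w≤2+m
  bound zero          w len pal | no w≰2+m = ⊥-elim (w≰2+m (subst (_≤ 2 + m) (sym len) z≤n))
  bound (suc zero)    w len pal | no w≰2+m = ⊥-elim (w≰2+m (subst (_≤ 2 + m) (sym len) (s≤s z≤n)))
  bound (suc (suc n)) w len pal | no w≰2+m with strip-palindrome n w len pal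
  ... | v , len-v , pal-v =
    ⊥-elim (w≰2+m (subst (_≤ 2 + m) (sym len) (+-monoʳ-≤ 2 (subst (_≤ m) len-v (bound n v len-v pal-v)))))

module _ {ω : Word} {p N : ℕ} (periodic : ∀ n → N ≤ n → ω (n + p) ≡ ω n) where

  letter-periodic : ∀ q n → N ≤ n → ω (n + q * p) ≡ ω n
  letter-periodic zero    n _   = cong ω (+-identityʳ n)
  letter-periodic (suc q) n N≤n =
    trans (cong ω (sym (+-assoc n p (q * p)))) (trans (letter-periodic q (n + p) (≤-trans N≤n (m≤m+n n p))) (periodic n N≤n))

  slice-periodic : ∀ q i n → N ≤ i → slice ω (i + q * p) n ≡ slice ω i n
  slice-periodic q i zero    _   = refl
  slice-periodic q i (suc n) N≤i =
    cong₂ _∷_ (letter-periodic q i N≤i) (slice-periodic q (suc i) n (≤-trans N≤i (n≤1+n i)))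

-- If ω[j, j+K) is the reversal of ω[N, N+K) and j ≡ N + r modulo the period,
-- then ω[N+r, N+K) is a palindrome of length K - r.
closed-periodic⇒long-palindrome : ∀ {ω} → ClosedUnderReversal ω → UltimatelyPeriodic ω →
                                  ∀ m → ∃ λ w → PalFactor ω w × m < length w
closed-periodic⇒long-palindrome {ω} closed (suc p′ , _ , N , periodic) m with reversal-occurs-beyond closed N (suc p′ + m) N
... | j , N≤j , reversed = Z , (slice-factor ω (N + r) s , Z-palindrome) , subst (m <_) (sym (length-slice ω (N + r) s)) m<s
  where
  p = suc p′
  r = (j ∸ N) % p
  q = (j ∸ N) / p
  s = p ∸ r + m
  Z = slice ω (N + r) s
  A = slice ω N r
  B = slice ω (N + r + s) r
  m<s : m < s
  m<s = m<n+m m (m<n⇒0<n∸m (m%n<n (j ∸ N) p))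
  r+s≡p+m : r + s ≡ p + m
  r+s≡p+m = trans (sym (+-assoc r (p ∸ r) m)) (cong (_+ m) (m+[n∸m]≡n (<⇒≤ (m%n<n (j ∸ N) p))))
  j≡N+r+q*p : j ≡ N + r + q * p
  j≡N+r+q*p = trans (sym (m+[n∸m]≡n N≤j)) (trans (cong (N +_) (m≡m%n+[m/n]*n (j ∸ N) p)) (sym (+-assoc N r (q * p))))
  open ≡-Reasoning
  swapped : Z ++ B ≡ reverse Z ++ reverse A
  swapped = begin
    Z ++ B                        ≡⟨ sym (slice-++ ω (N + r) s r) ⟩
    slice ω (N + r) (s + r)       ≡⟨ cong (slice ω (N + r)) (trans (+-comm s r) r+s≡p+m) ⟩
    slice ω (N + r) (p + m)       ≡⟨ sym (slice-periodic periodic q (N + r) (p + m) (m≤m+n N r)) ⟩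
    slice ω (N + r + q * p) (p + m) ≡⟨ cong (λ k → slice ω k (p + m)) (sym j≡N+r+q*p) ⟩
    slice ω j (p + m)             ≡⟨ reversed ⟩
    reverse (slice ω N (p + m))   ≡⟨ cong (λ k → reverse (slice ω N k)) (sym r+s≡p+m) ⟩
    reverse (slice ω N (r + s))   ≡⟨ cong reverse (slice-++ ω N r s) ⟩
    reverse (A ++ Z)              ≡⟨ reverse-++ A Z ⟩
    reverse Z ++ reverse A        ∎
  Z-palindrome : reverse Z ≡ Z
  Z-palindrome = sym (proj₁ (++-injective Z (reverse Z) (sym (length-reverse Z)) swapped))

bounded-palindromes⇒aperiodic : ∀ {ω} m → ClosedUnderReversal ω → (∀ w → PalFactor ω w → length w ≤ m) → Aperiodic ω
bounded-palindromes⇒aperiodic m closed bound periodic with closed-periodic⇒long-palindrome closed periodic m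
... | w , pal , m<w = <⇒≱ m<w (bound w pal)

-- The search

∧-true : ∀ {x y} → x ∧ y ≡ true → x ≡ true × y ≡ true
∧-true {true} {true} _ = refl , refl

∨-true : ∀ {x y} → x ∨ y ≡ true → x ≡ true ⊎ y ≡ true
∨-true {true}  _ = inj₁ refl
∨-true {false} e = inj₂ e

not-true : ∀ {x} → not x ≡ true → x ≡ false
not-true {false} _ = refl

_≡ˡ_ : Letter → Letter → Bool
a ≡ˡ a = true
b ≡ˡ b = true
a ≡ˡ b = false
b ≡ˡ a = false

_≡ʷ_ : List Letter → List Letter → Bool
[]       ≡ʷ []       = true
[]       ≡ʷ (_ ∷ _)  = false
(_ ∷ _)  ≡ʷ []       = false
(x ∷ xs) ≡ʷ (y ∷ ys) = (x ≡ˡ y) ∧ (xs ≡ʷ ys)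

_∈ʷ_ : List Letter → List (List Letter) → Bool
x ∈ʷ []       = false
x ∈ʷ (y ∷ ys) = (x ≡ʷ y) ∨ (x ∈ʷ ys)

isPalindrome : List Letter → Bool
isPalindrome w = reverse w ≡ʷ w

isPrefixOf : List Letter → List Letter → Bool
isPrefixOf []       _        = true
isPrefixOf (_ ∷ _)  []       = false
isPrefixOf (x ∷ xs) (y ∷ ys) = (x ≡ˡ y) ∧ isPrefixOf xs ys

≡ˡ-sound : ∀ x y → x ≡ˡ y ≡ true → x ≡ y
≡ˡ-sound a a _ = refl
≡ˡ-sound b b _ = refl

≡ˡ-refl : ∀ x → x ≡ˡ x ≡ true
≡ˡ-refl a = refl
≡ˡ-refl b = refl

≡ʷ-sound : ∀ x y → x ≡ʷ y ≡ true → x ≡ y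
≡ʷ-sound []       []       _ = refl
≡ʷ-sound (x ∷ xs) (y ∷ ys) e with ∧-true {x ≡ˡ y} e
... | e₁ , e₂ = cong₂ _∷_ (≡ˡ-sound x y e₁) (≡ʷ-sound xs ys e₂)

≡ʷ-refl : ∀ x → x ≡ʷ x ≡ true
≡ʷ-refl []       = refl
≡ʷ-refl (x ∷ xs) rewrite ≡ˡ-refl x = ≡ʷ-refl xs

≡ʷ-false : ∀ x y → x ≢ y → x ≡ʷ y ≡ false
≡ʷ-false x y x≢y with x ≡ʷ y in e
... | true  = ⊥-elim (x≢y (≡ʷ-sound x y e))
... | false = refl

∈ʷ-sound : ∀ x ys → x ∈ʷ ys ≡ true → x ∈ ys
∈ʷ-sound x (y ∷ ys) e with ∨-true {x ≡ʷ y} e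
... | inj₁ e₁ = here (≡ʷ-sound x y e₁)
... | inj₂ e₂ = there (∈ʷ-sound x ys e₂)

∈ʷ-complete : ∀ x ys → x ∈ ys → x ∈ʷ ys ≡ true
∈ʷ-complete x (y ∷ ys) (here refl) rewrite ≡ʷ-refl x = refl
∈ʷ-complete x (y ∷ ys) (there x∈ys) rewrite ∈ʷ-complete x ys x∈ys with x ≡ʷ y
... | true  = refl
... | false = refl

isPalindrome-sound : ∀ w → isPalindrome w ≡ true → reverse w ≡ w
isPalindrome-sound w = ≡ʷ-sound (reverse w) w

isPrefixOf-sound : ∀ q w → isPrefixOf q w ≡ true → ∃ λ r → w ≡ q ++ r
isPrefixOf-sound []       w        _ = w , refl
isPrefixOf-sound (x ∷ xs) (y ∷ ys) e with ∧-true {x ≡ˡ y} e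
... | e₁ , e₂ with isPrefixOf-sound xs ys e₂
... | r , eq = r , cong₂ _∷_ (sym (≡ˡ-sound x y e₁)) eq

data Status : Set where
  unknown present absent : Status

data StatusTrie : Set where
  leaf : StatusTrie
  node : Status → StatusTrie → StatusTrie → StatusTrie

statusOf : StatusTrie → List Letter → Status
statusOf leaf          _       = unknown
statusOf (node s _ _)  []      = s
statusOf (node _ tᵃ _) (a ∷ w) = statusOf tᵃ w
statusOf (node _ _ tᵇ) (b ∷ w) = statusOf tᵇ w

setStatus : StatusTrie → List Letter → Status → StatusTrie
setStatus leaf           []      s = node s leaf leaf
setStatus leaf           (a ∷ w) s = node unknown (setStatus leaf w s) leaf
setStatus leaf           (b ∷ w) s = node unknown leaf (setStatus leaf w s)
setStatus (node _ tᵃ tᵇ) []      s = node s tᵃ tᵇ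
setStatus (node t tᵃ tᵇ) (a ∷ w) s = node t (setStatus tᵃ w s) tᵇ
setStatus (node t tᵃ tᵇ) (b ∷ w) s = node t tᵃ (setStatus tᵇ w s)

isAbsent : Status → Bool
isAbsent absent = true
isAbsent _      = false

isUnknown : Status → Bool
isUnknown unknown = true
isUnknown _       = false

-- A backward window together with the list of its palindromic prefixes.
data Candidate : Set where
  candidate : List Letter → List (List Letter) → Candidate

window : Candidate → List Letter
window (candidate w _) = w

hasLetterAt : List Letter → ℕ → Letter → Bool
hasLetterAt []       _       _ = false
hasLetterAt (y ∷ ys) zero    x = y ≡ˡ x
hasLetterAt (y ∷ ys) (suc k) x = hasLetterAt ys k x

-- The palindromic prefixes of x ∷ w are ε, x and the x s x for palindromic prefixes s of w followed by x.
extendPalPrefixes : Letter → List Letter → List (List Letter) → List (List Letter)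
extendPalPrefixes x w []       = []
extendPalPrefixes x w (s ∷ ss) =
  if hasLetterAt w (length s) x then (x ∷ (s ++ x ∷ [])) ∷ extendPalPrefixes x w ss else extendPalPrefixes x w ss

extendCandidate : Letter → Candidate → Candidate
extendCandidate x (candidate w ps) = candidate (x ∷ w) ([] ∷ (x ∷ []) ∷ extendPalPrefixes x w ps)

extensions : List Candidate → List Candidate
extensions []       = []
extensions (e ∷ es) = extendCandidate a e ∷ extendCandidate b e ∷ extensions es

palPrefixes : List Candidate → List (List Letter)
palPrefixes []                     = []
palPrefixes (candidate _ ps ∷ es) = ps ++ palPrefixes es

-- Rechecking that q is a palindromic prefix keeps the soundness proof independent of extendPalPrefixes.
hasAbsentPalPrefix : StatusTrie → List Letter → List (List Letter) → Bool
hasAbsentPalPrefix D w []       = false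
hasAbsentPalPrefix D w (q ∷ qs) =
  (isAbsent (statusOf D q) ∧ isPalindrome q ∧ isPrefixOf q w) ∨ hasAbsentPalPrefix D w qs

dropExcluded : StatusTrie → List Candidate → List Candidate
dropExcluded D []                     = []
dropExcluded D (candidate w ps ∷ cs) =
  if hasAbsentPalPrefix D w ps then dropExcluded D cs else candidate w ps ∷ dropExcluded D cs

dropHead : List Letter → List Letter
dropHead []       = []
dropHead (_ ∷ xs) = xs

dropLast : List Letter → List Letter
dropLast []           = []
dropLast (x ∷ [])     = []
dropLast (x ∷ y ∷ xs) = x ∷ dropLast (y ∷ xs)

Edge : Set
Edge = List Letter × List Letter

-- A backward window of length n + 1 at position i joins the windows of length n at i and i + 1.
edges : List Candidate → List Edge
edges []                    = []
edges (candidate e _ ∷ es) = (dropHead e , dropLast e) ∷ edges es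

select : (List Letter → Bool) → List (List Letter) → List (List Letter)
select p []       = []
select p (x ∷ xs) = if p x then x ∷ select p xs else select p xs

hasSuccessor : List Edge → List (List Letter) → List Letter → Bool
hasSuccessor []             X v = false
hasSuccessor ((s , t) ∷ es) X v = (s ≡ʷ v ∧ t ∈ʷ X) ∨ hasSuccessor es X v

hasPredecessor : List Edge → List (List Letter) → List Letter → Bool
hasPredecessor []             X v = false
hasPredecessor ((s , t) ∷ es) X v = (t ≡ʷ v ∧ s ∈ʷ X) ∨ hasPredecessor es X v

viable : List Edge → List (List Letter) → List Letter → Bool
viable E X v = hasSuccessor E X v ∧ hasPredecessor E X v ∧ reverse v ∈ʷ X

-- The helper functions ending in ′ receive an already computed value, so that it is evaluated once.
pruneOnce : List Edge → List (List Letter) → List (List Letter)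
pruneOnce E X = select (viable E X) X

prune′ : ℕ → List Edge → List (List Letter) → List (List Letter) → List (List Letter)
prune : ℕ → List Edge → List (List Letter) → List (List Letter)
prune zero    E X = X
prune (suc k) E X = prune′ k E X (pruneOnce E X)

prune′ k E X X′ = if length X′ ≡ᵇ length X then X else prune k E X′

reachStep : List Edge → List (List Letter) → List (List Letter) → List (List Letter) → List (List Letter)
reachStep []             X R acc = acc
reachStep ((s , t) ∷ es) X R acc =
  if s ∈ʷ R ∧ t ∈ʷ X ∧ not (t ∈ʷ acc) then reachStep es X R (t ∷ acc) else reachStep es X R acc

successors : List Edge → List (List Letter) → List Letter → List (List Letter)
successors []             X v = []
successors ((s , t) ∷ es) X v = if s ≡ʷ v ∧ t ∈ʷ X then t ∷ successors es X v else successors es X v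

reachable′ : ℕ → List Edge → List (List Letter) → List (List Letter) → List (List Letter) → List (List Letter)
reachable : ℕ → List Edge → List (List Letter) → List (List Letter) → List (List Letter)
reachable zero    E X R = R
reachable (suc k) E X R = reachable′ k E X R (reachStep E X R R)

reachable′ k E X R R′ = if length R′ ≡ᵇ length R then R else reachable k E X R′

successorsIn : List Edge → List (List Letter) → List (List Letter) → List Letter → Bool
successorsIn []             X R v = true
successorsIn ((s , t) ∷ es) X R v = (not (s ≡ʷ v ∧ t ∈ʷ X) ∨ t ∈ʷ R) ∧ successorsIn es X R v

forwardClosed : List Edge → List (List Letter) → List (List Letter) → Bool
forwardClosed []             X R = true
forwardClosed ((s , t) ∷ es) X R = (not (s ∈ʷ R ∧ t ∈ʷ X) ∨ t ∈ʷ R) ∧ forwardClosed es X R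

-- Everything after an occurrence of v stays in R, but the reversal of v has to occur later on.
excludes : List Edge → List (List Letter) → List Letter → List (List Letter) → Bool
excludes E X v R = not (reverse v ∈ʷ R) ∧ successorsIn E X R v ∧ forwardClosed E X R

removable : List Edge → List (List Letter) → List Letter → Bool
removable E X v = excludes E X v (reachable (length X) E X (successors E X v))

removeAll : List Edge → List (List Letter) → List (List Letter) → List (List Letter)
removeAll E X []       = X
removeAll E X (v ∷ vs) =
  if removable E X v then removeAll E (select (λ x → not (x ≡ʷ v)) X) vs else removeAll E X vs

reduce : List Edge → List (List Letter) → List (List Letter)
reduce E X = removeAll E X X

exhausts′ : ℕ → List Edge → List (List Letter) → List (List Letter) → Bool
exhausts : ℕ → List Edge → List (List Letter) → Bool
exhausts _       E []          = true
exhausts zero    E (_ ∷ _)     = false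
exhausts (suc k) E X@(_ ∷ _)   = exhausts′ k E X (reduce E (prune (length X) E X))

exhausts′ k E X X′ = if length X′ ≡ᵇ length X then false else exhausts k E X′

graphRefutes′ : Bool → List (List Letter) → List Edge → Bool
graphRefutes : Bool → List Candidate → List Candidate → Bool
graphRefutes full W W⁺ = graphRefutes′ full (map window W) (edges W⁺)

graphRefutes′ full X E = if full then exhausts (length X) E X else null (prune (length X) E X)

isZero : ℕ → Bool
isZero zero    = true
isZero (suc _) = false

-- Depth-first search over the windows of length n, branching on whether each newly seen palindrome
-- is a factor; `found` lists the palindromes decided to be factors, of which at most `bound` are allowed.
module Search (bound : ℕ) where

  level′ : ℕ → ℕ → List Candidate → List (List Letter) → StatusTrie → List Candidate → Bool
  decide : ℕ → ℕ → List Candidate → List Candidate → List (List Letter) → StatusTrie → List (List Letter) → Bool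
  decide′ : ℕ → ℕ → List Candidate → List (List Letter) → StatusTrie → List Candidate → Bool
  next : ℕ → ℕ → List Candidate → List (List Letter) → StatusTrie → Bool

  level : ℕ → ℕ → List Candidate → List (List Letter) → StatusTrie → Bool
  level k n []        found D = true
  level k n W@(_ ∷ _) found D = level′ k n W found D (extensions W)

  level′ k n W found D C = decide k n W C found D (palPrefixes C)

  decide k n W C found D (q ∷ qs) =
    if isUnknown (statusOf D q)
    then (decide k n W C found (setStatus D q absent) qs ∧
          (if bound ≤ᵇ length found then true else decide k n W C (q ∷ found) (setStatus D q present) qs))
    else decide k n W C found D qs
  decide k n W C found D [] = decide′ k n W found D (dropExcluded D C)

  decide′ k n W found D W⁺ = ((2 ≤ᵇ n) ∧ graphRefutes (isZero k) W W⁺) ∨ next k (suc n) W⁺ found D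

  next zero    n W found D = false
  next (suc k) n W found D = level k n W found D

  search : ℕ → Bool
  search depth = level depth 0 (candidate [] ([] ∷ []) ∷ []) [] leaf

Unique-⊆⇒length≤ : ∀ {A : Set} (xs ys : List A) → Unique xs → All (_∈ ys) xs → length xs ≤ length ys
Unique-⊆⇒length≤ []       ys _             _            = z≤n
Unique-⊆⇒length≤ (x ∷ xs) ys (x∉xs ∷ uxs) (x∈ys ∷ xs⊆ys) with ∈-∃++ x∈ys
... | ys₁ , ys₂ , refl =
  ≤-trans (s≤s (Unique-⊆⇒length≤ xs (ys₁ ++ ys₂) uxs (remove xs x∉xs xs⊆ys))) (≤-reflexive (sym (length-++-sucʳ ys₁ x ys₂)))
  where
  remove-x : ∀ {y} → y ∈ ys₁ ++ x ∷ ys₂ → x ≢ y → y ∈ ys₁ ++ ys₂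
  remove-x y∈ x≢y with ∈-++⁻ ys₁ y∈
  ... | inj₁ y∈ys₁          = ∈-++⁺ˡ y∈ys₁
  ... | inj₂ (here refl)    = ⊥-elim (x≢y refl)
  ... | inj₂ (there y∈ys₂)  = ∈-++⁺ʳ ys₁ y∈ys₂
  remove : ∀ zs → All (x ≢_) zs → All (_∈ ys₁ ++ x ∷ ys₂) zs → All (_∈ ys₁ ++ ys₂) zs
  remove []       []          []         = []
  remove (z ∷ zs) (x≢z ∷ ne) (z∈ ∷ zs∈) = remove-x z∈ x≢z ∷ remove zs ne zs∈

if-elim : ∀ {A : Set} (P : A → Set) b {x y} → P x → P y → P (if b then x else y)
if-elim P true  px _  = px
if-elim P false _  py = py

if-true : ∀ b {x y} → (if b then x else y) ≡ true → (b ≡ true × x ≡ true) ⊎ (b ≡ false × y ≡ true)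
if-true true  h = inj₁ (refl , h)
if-true false h = inj₂ (refl , h)

unknown≢present : unknown ≢ present
unknown≢present ()

isAbsent-true : ∀ s → isAbsent s ≡ true → s ≡ absent
isAbsent-true absent _ = refl

isUnknown-true : ∀ s → isUnknown s ≡ true → s ≡ unknown
isUnknown-true unknown _ = refl

statusOf-leaf : ∀ q → statusOf leaf q ≡ unknown
statusOf-leaf []      = refl
statusOf-leaf (a ∷ q) = refl
statusOf-leaf (b ∷ q) = refl

statusOf-setStatus : ∀ D q s → statusOf (setStatus D q s) q ≡ s
statusOf-setStatus leaf           []      s = refl
statusOf-setStatus leaf           (a ∷ q) s = statusOf-setStatus leaf q s
statusOf-setStatus leaf           (b ∷ q) s = statusOf-setStatus leaf q s
statusOf-setStatus (node _ _ _)   []      s = refl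
statusOf-setStatus (node t tᵃ tᵇ) (a ∷ q) s = statusOf-setStatus tᵃ q s
statusOf-setStatus (node t tᵃ tᵇ) (b ∷ q) s = statusOf-setStatus tᵇ q s

-- setStatus treats a leaf as an unknown node with leaf children.
statusOf-setStatus-other : ∀ D q q′ s → q′ ≢ q → statusOf (setStatus D q s) q′ ≡ statusOf D q′
statusOf-setStatus-other-node : ∀ t tᵃ tᵇ q q′ s → q′ ≢ q →
                                statusOf (setStatus (node t tᵃ tᵇ) q s) q′ ≡ statusOf (node t tᵃ tᵇ) q′

statusOf-setStatus-other (node t tᵃ tᵇ) q q′ s ne = statusOf-setStatus-other-node t tᵃ tᵇ q q′ s ne
statusOf-setStatus-other leaf q q′ s ne = begin
  statusOf (setStatus leaf q s) q′                       ≡⟨ cong (λ D → statusOf D q′) (as-node q) ⟩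
  statusOf (setStatus (node unknown leaf leaf) q s) q′   ≡⟨ statusOf-setStatus-other-node unknown leaf leaf q q′ s ne ⟩
  statusOf (node unknown leaf leaf) q′                   ≡⟨ node-unknown q′ ⟩
  statusOf leaf q′                                       ∎
  where
  open ≡-Reasoning
  as-node : ∀ q → setStatus leaf q s ≡ setStatus (node unknown leaf leaf) q s
  as-node []      = refl
  as-node (a ∷ _) = refl
  as-node (b ∷ _) = refl
  node-unknown : ∀ q → statusOf (node unknown leaf leaf) q ≡ statusOf leaf q
  node-unknown []      = refl
  node-unknown (a ∷ q) = sym (statusOf-leaf q)
  node-unknown (b ∷ q) = sym (statusOf-leaf q)

statusOf-setStatus-other-node t tᵃ tᵇ []      []       s ne = ⊥-elim (ne refl)
statusOf-setStatus-other-node t tᵃ tᵇ []      (a ∷ q′) s ne = refl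
statusOf-setStatus-other-node t tᵃ tᵇ []      (b ∷ q′) s ne = refl
statusOf-setStatus-other-node t tᵃ tᵇ (a ∷ q) []       s ne = refl
statusOf-setStatus-other-node t tᵃ tᵇ (a ∷ q) (a ∷ q′) s ne = statusOf-setStatus-other tᵃ q q′ s (ne ∘ cong (a ∷_))
statusOf-setStatus-other-node t tᵃ tᵇ (a ∷ q) (b ∷ q′) s ne = refl
statusOf-setStatus-other-node t tᵃ tᵇ (b ∷ q) []       s ne = refl
statusOf-setStatus-other-node t tᵃ tᵇ (b ∷ q) (a ∷ q′) s ne = refl
statusOf-setStatus-other-node t tᵃ tᵇ (b ∷ q) (b ∷ q′) s ne = statusOf-setStatus-other tᵇ q q′ s (ne ∘ cong (b ∷_))

select-keeps : ∀ p xs x → x ∈ xs → p x ≡ true → x ∈ select p xs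
select-keeps p (y ∷ xs) x (here refl) px rewrite px = here refl
select-keeps p (y ∷ xs) x (there x∈) px with p y
... | true  = there (select-keeps p xs x x∈ px)
... | false = select-keeps p xs x x∈ px

extensions-complete : ∀ W w x → w ∈ map window W → x ∷ w ∈ map window (extensions W)
extensions-complete (candidate _ _ ∷ W) w a (here refl) = here refl
extensions-complete (candidate _ _ ∷ W) w b (here refl) = there (here refl)
extensions-complete (candidate _ _ ∷ W) w x (there w∈)  = there (there (extensions-complete W w x w∈))

hasAbsentPalPrefix-sound : ∀ D w qs → hasAbsentPalPrefix D w qs ≡ true →
                           ∃ λ q → statusOf D q ≡ absent × isPalindrome q ≡ true × isPrefixOf q w ≡ true
hasAbsentPalPrefix-sound D w (q ∷ qs) h with ∨-true {isAbsent (statusOf D q) ∧ isPalindrome q ∧ isPrefixOf q w} h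
... | inj₂ h′ = hasAbsentPalPrefix-sound D w qs h′
... | inj₁ h′ with ∧-true {isAbsent (statusOf D q)} h′
...   | abs , h″ with ∧-true {isPalindrome q} h″
...     | pal , pre = q , isAbsent-true (statusOf D q) abs , pal , pre

dropExcluded-keeps : ∀ D C w → w ∈ map window C → (∀ ps → hasAbsentPalPrefix D w ps ≢ true) →
                     w ∈ map window (dropExcluded D C)
dropExcluded-keeps D (candidate w ps ∷ C) _ (here refl) ok with hasAbsentPalPrefix D w ps in e
... | true  = ⊥-elim (ok ps e)
... | false = here refl
dropExcluded-keeps D (candidate w ps ∷ C) v (there v∈) ok with hasAbsentPalPrefix D w ps
... | true  = dropExcluded-keeps D C v v∈ ok
... | false = there (dropExcluded-keeps D C v v∈ ok)

edges-complete : ∀ W e → e ∈ map window W → (dropHead e , dropLast e) ∈ edges W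
edges-complete (candidate _ _ ∷ W) e (here refl) = here refl
edges-complete (candidate _ _ ∷ W) e (there e∈)  = there (edges-complete W e e∈)

hasSuccessor-complete : ∀ E X s t → (s , t) ∈ E → t ∈ʷ X ≡ true → hasSuccessor E X s ≡ true
hasSuccessor-complete ((s , t) ∷ E) X s t (here refl) t∈X rewrite ≡ʷ-refl s | t∈X = refl
hasSuccessor-complete ((s′ , t′) ∷ E) X s t (there e∈) t∈X rewrite hasSuccessor-complete E X s t e∈ t∈X
  with s′ ≡ʷ s ∧ t′ ∈ʷ X
... | true  = refl
... | false = refl

hasPredecessor-complete : ∀ E X s t → (s , t) ∈ E → s ∈ʷ X ≡ true → hasPredecessor E X t ≡ true
hasPredecessor-complete ((s , t) ∷ E) X s t (here refl) s∈X rewrite ≡ʷ-refl t | s∈X = refl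
hasPredecessor-complete ((s′ , t′) ∷ E) X s t (there e∈) s∈X rewrite hasPredecessor-complete E X s t e∈ s∈X
  with t′ ≡ʷ t ∧ s′ ∈ʷ X
... | true  = refl
... | false = refl

successorsIn-sound : ∀ E X R v t → successorsIn E X R v ≡ true → (v , t) ∈ E → t ∈ʷ X ≡ true → t ∈ʷ R ≡ true
successorsIn-sound ((v , t) ∷ E) X R v t ok (here refl) t∈X
  with ∧-true {not (v ≡ʷ v ∧ t ∈ʷ X) ∨ t ∈ʷ R} ok
... | ok₁ , _ rewrite ≡ʷ-refl v | t∈X = ok₁
successorsIn-sound ((s′ , t′) ∷ E) X R v t ok (there e∈) t∈X =
  successorsIn-sound E X R v t (proj₂ (∧-true {not (s′ ≡ʷ v ∧ t′ ∈ʷ X) ∨ t′ ∈ʷ R} ok)) e∈ t∈X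

forwardClosed-sound : ∀ E X R s t → forwardClosed E X R ≡ true → (s , t) ∈ E →
                      s ∈ʷ R ≡ true → t ∈ʷ X ≡ true → t ∈ʷ R ≡ true
forwardClosed-sound ((s , t) ∷ E) X R s t ok (here refl) s∈R t∈X
  with ∧-true {not (s ∈ʷ R ∧ t ∈ʷ X) ∨ t ∈ʷ R} ok
... | ok₁ , _ rewrite s∈R | t∈X = ok₁
forwardClosed-sound ((s′ , t′) ∷ E) X R s t ok (there e∈) s∈R t∈X =
  forwardClosed-sound E X R s t (proj₂ (∧-true {not (s′ ∈ʷ R ∧ t′ ∈ʷ X) ∨ t′ ∈ʷ R} ok)) e∈ s∈R t∈X

dropLast-revSlice : ∀ ω i n → dropLast (revSlice ω i (suc n)) ≡ revSlice ω (suc i) n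
dropLast-revSlice ω i zero    = refl
dropLast-revSlice ω i (suc m) = cong₂ _∷_ (cong ω (+-suc i m)) (dropLast-revSlice ω i m)

module Soundness (bound : ℕ) {ω : Word} (closed : ClosedUnderReversal ω) (L : List (List Letter))
                 (covers : ∀ w → PalFactor ω w → w ∈ L) (few : length L ≤ bound) where

  open Search bound

  revSlice-beyond : ∀ n i k → ∃ λ j → k ≤ j × revSlice ω j n ≡ revSlice ω i n
  revSlice-beyond n i k with occurs-beyond closed i n k
  ... | j , k≤j , e =
    j , k≤j , trans (revSlice≡reverse-slice ω j n) (trans (cong reverse e) (sym (revSlice≡reverse-slice ω i n)))

  revSlice-reversal-beyond : ∀ n i k → ∃ λ j → k ≤ j × revSlice ω j n ≡ reverse (revSlice ω i n)
  revSlice-reversal-beyond n i k with reversal-occurs-beyond closed i n k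
  ... | j , k≤j , e = j , k≤j , (begin
    revSlice ω j n                        ≡⟨ revSlice≡reverse-slice ω j n ⟩
    reverse (slice ω j n)                 ≡⟨ cong reverse e ⟩
    reverse (reverse (slice ω i n))       ≡⟨ cong reverse (sym (revSlice≡reverse-slice ω i n)) ⟩
    reverse (revSlice ω i n)              ∎)
    where open ≡-Reasoning

  palindromic-prefix∈L : ∀ i m q → isPalindrome q ≡ true → isPrefixOf q (revSlice ω i m) ≡ true → q ∈ L
  palindromic-prefix∈L i m q pal pre with isPrefixOf-sound q (revSlice ω i m) pre
  ... | r , e = covers q (subst (λ v → Factor v ω) pal′ (revSlice-prefix-factor ω i q r (trans (cong (revSlice ω i) m≡) e)) ,
                         pal′)
    where
    pal′ : reverse q ≡ q
    pal′ = isPalindrome-sound q pal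
    m≡ : length q + length r ≡ m
    m≡ = trans (sym (length-++ q)) (trans (cong length (sym e)) (length-revSlice ω i m))

  WindowsIn : ℕ → List (List Letter) → Set
  WindowsIn n X = ∀ i → revSlice ω i n ∈ X

  EdgesIn : ℕ → List Edge → Set
  EdgesIn n E = ∀ i → (revSlice ω i n , revSlice ω (suc i) n) ∈ E

  AbsentSound : StatusTrie → Set
  AbsentSound D = ∀ q → statusOf D q ≡ absent → q ∉ L

  FoundSound : List (List Letter) → StatusTrie → Set
  FoundSound found D = All (λ q → statusOf D q ≡ present) found × Unique found × All (_∈ L) found

  WindowsIn-nonempty : ∀ {n} → WindowsIn n [] → ⊥
  WindowsIn-nonempty windows with windows 0
  ... | ()

  viable-window : ∀ n E X i → WindowsIn n X → EdgesIn n E → viable E X (revSlice ω i n) ≡ true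
  viable-window n E X i windows edges with revSlice-beyond n i 1 | revSlice-reversal-beyond n i 0
  ... | suc j , _ , eʲ | j′ , _ , eʲ′
    rewrite hasSuccessor-complete E X _ _ (edges i) (∈ʷ-complete _ X (windows (suc i)))
          | hasPredecessor-complete E X _ _ (subst (λ v → (revSlice ω j n , v) ∈ E) eʲ (edges j)) (∈ʷ-complete _ X (windows j))
          | sym eʲ′ = ∈ʷ-complete _ X (windows j′)

  prune-complete : ∀ n k E X → WindowsIn n X → EdgesIn n E → WindowsIn n (prune k E X)
  prune-complete n zero    E X windows edges = windows
  prune-complete n (suc k) E X windows edges =
    if-elim (WindowsIn n) (length (pruneOnce E X) ≡ᵇ length X) windows (prune-complete n k E (pruneOnce E X) pruned edges)
    where
    pruned : WindowsIn n (pruneOnce E X)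
    pruned i = select-keeps (viable E X) X _ (windows i) (viable-window n E X i windows edges)

  excluded-window : ∀ n E X R v → WindowsIn n X → EdgesIn n E → excludes E X v R ≡ true → ∀ i → revSlice ω i n ≢ v
  excluded-window n E X R v windows edges h i refl with ∧-true {not (reverse v ∈ʷ R)} h
  ... | not-in-R , h′ with ∧-true {successorsIn E X R v} h′
  ... | succ , closed-R with revSlice-reversal-beyond n i (suc i)
  ... | j , i<j , eʲ = contradiction
    where
    in-X : ∀ k → revSlice ω k n ∈ʷ X ≡ true
    in-X k = ∈ʷ-complete _ X (windows k)
    later : ∀ d → revSlice ω (suc (d + i)) n ∈ʷ R ≡ true
    later zero    = successorsIn-sound E X R v _ succ (edges i) (in-X (suc i))
    later (suc d) = forwardClosed-sound E X R _ _ closed-R (edges (suc (d + i))) (later d) (in-X (suc (suc (d + i))))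
    j≡ : suc ((j ∸ suc i) + i) ≡ j
    j≡ = trans (sym (+-suc (j ∸ suc i) i)) (m∸n+n≡m i<j)
    reverse-in-R : reverse v ∈ʷ R ≡ true
    reverse-in-R = subst (λ x → x ∈ʷ R ≡ true) eʲ (subst (λ k → revSlice ω k n ∈ʷ R ≡ true) j≡ (later (j ∸ suc i)))
    contradiction : ⊥
    contradiction with trans (sym reverse-in-R) (not-true not-in-R)
    ... | ()

  removeAll-complete : ∀ n E X vs → WindowsIn n X → EdgesIn n E → WindowsIn n (removeAll E X vs)
  removeAll-complete n E X []       windows edges = windows
  removeAll-complete n E X (v ∷ vs) windows edges with removable E X v in rm
  ... | true  = removeAll-complete n E _ vs kept edges
    where
    kept : WindowsIn n (select (λ x → not (x ≡ʷ v)) X)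
    kept i = select-keeps _ X _ (windows i)
               (cong not (≡ʷ-false _ v (excluded-window n E X R v windows edges rm i)))
      where R = reachable (length X) E X (successors E X v)
  ... | false = removeAll-complete n E X vs windows edges

  exhausts-sound : ∀ n k E X → WindowsIn n X → EdgesIn n E → exhausts k E X ≡ true → ⊥
  exhausts-sound n k       E []      windows edges _ = WindowsIn-nonempty windows
  exhausts-sound n zero    E (x ∷ X) windows edges ()
  exhausts-sound n (suc k) E (x ∷ X) windows edges h
    with if-true (length (reduce E (prune (length (x ∷ X)) E (x ∷ X))) ≡ᵇ length (x ∷ X)) h
  ... | inj₁ (_ , ())
  ... | inj₂ (_ , h′) = exhausts-sound n k E (reduce E X′) reduced edges h′
    where
    X′ = prune (length (x ∷ X)) E (x ∷ X)
    reduced : WindowsIn n (reduce E X′)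
    reduced = removeAll-complete n E X′ X′ (prune-complete n (length (x ∷ X)) E (x ∷ X) windows edges) edges

  graphRefutes-sound : ∀ full n W W⁺ → WindowsIn n (map window W) → WindowsIn (suc n) (map window W⁺) →
                       graphRefutes full W W⁺ ≡ true → ⊥
  graphRefutes-sound full n W W⁺ windows windows⁺ = refute full
    where
    E = edges W⁺
    X = map window W
    edges-in : EdgesIn n E
    edges-in i = subst (λ v → (revSlice ω i n , v) ∈ E) (dropLast-revSlice ω i n) (edges-complete W⁺ _ (windows⁺ i))
    null-true : ∀ {A : Set} (xs : List A) → null xs ≡ true → xs ≡ []
    null-true [] _ = refl
    refute : ∀ f → graphRefutes′ f X E ≡ true → ⊥
    refute true  h = exhausts-sound n _ E X windows edges-in h
    refute false h = WindowsIn-nonempty (subst (WindowsIn n) (null-true (prune (length X) E X) h)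
                                               (prune-complete n (length X) E X windows edges-in))

  AbsentSound-absent : ∀ D q → q ∉ L → AbsentSound D → AbsentSound (setStatus D q absent)
  AbsentSound-absent D q q∉L sound q′ abs with q′ ≟ʷ q
  ... | yes refl = q∉L
  ... | no q′≢q  = sound q′ (trans (sym (statusOf-setStatus-other D q q′ absent q′≢q)) abs)

  AbsentSound-present : ∀ D q → AbsentSound D → AbsentSound (setStatus D q present)
  AbsentSound-present D q sound q′ abs with q′ ≟ʷ q
  ... | yes refl with trans (sym (statusOf-setStatus D q present)) abs
  ...   | ()
  AbsentSound-present D q sound q′ abs | no q′≢q = sound q′ (trans (sym (statusOf-setStatus-other D q q′ present q′≢q)) abs)

  present-setStatus : ∀ D q s found → statusOf D q ≡ unknown → All (λ t → statusOf D t ≡ present) found →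
                      All (λ t → statusOf (setStatus D q s) t ≡ present) found
  present-setStatus D q s found unk =
    All.map λ {t} pres → trans (statusOf-setStatus-other D q t s λ { refl → unknown≢present (trans (sym unk) pres) }) pres

  FoundSound-absent : ∀ D q found → statusOf D q ≡ unknown → FoundSound found D → FoundSound found (setStatus D q absent)
  FoundSound-absent D q found unk (pres , uniq , inL) = present-setStatus D q absent found unk pres , uniq , inL

  FoundSound-present : ∀ D q found → statusOf D q ≡ unknown → q ∈ L → FoundSound found D →
                       FoundSound (q ∷ found) (setStatus D q present)
  FoundSound-present D q found unk q∈L (pres , uniq , inL) =
    (statusOf-setStatus D q present ∷ present-setStatus D q present found unk pres) ,
    All.map (λ {t} pres-t q≡t → unknown≢present (trans (sym unk) (trans (cong (statusOf D) q≡t) pres-t))) pres ∷ uniq ,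
    q∈L ∷ inL

  -- The branch adding q to `found` is only cut off when `found` is full, which the pigeonhole principle forbids.
  full-impossible : ∀ q found D → q ∈ L → statusOf D q ≡ unknown → FoundSound found D → (bound ≤ᵇ length found) ≡ true → ⊥
  full-impossible q found D q∈L unk sound full with FoundSound-present D q found unk q∈L sound
  ... | _ , uniq , inL =
    <⇒≱ (≤-trans (Unique-⊆⇒length≤ (q ∷ found) L uniq inL) few) (≤ᵇ⇒≤ bound (length found) (subst T (sym full) tt))

  CandidatesCover : ℕ → List Candidate → Set
  CandidatesCover n W = WindowsIn n (map window W)

  dropExcluded-cover : ∀ n D C → AbsentSound D → CandidatesCover (suc n) C → CandidatesCover (suc n) (dropExcluded D C)
  dropExcluded-cover n D C ab cover i = dropExcluded-keeps D C _ (cover i) λ ps h →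
    let (q , abs , pal , pre) = hasAbsentPalPrefix-sound D _ ps h
    in  ab q abs (palindromic-prefix∈L i (suc n) q pal pre)

  mutual
    level-sound : ∀ k n W found D → CandidatesCover n W → AbsentSound D → FoundSound found D → level k n W found D ≡ true → ⊥
    level-sound k n []      found D cover ab fs _ = WindowsIn-nonempty cover
    level-sound k n (w ∷ W) found D cover ab fs h =
      decide-sound k n (w ∷ W) (extensions (w ∷ W)) found D (palPrefixes (extensions (w ∷ W))) cover
        (λ i → extensions-complete (w ∷ W) (revSlice ω i n) (ω (i + n)) (cover i)) ab fs h

    decide-sound : ∀ k n W C found D qs → CandidatesCover n W → CandidatesCover (suc n) C → AbsentSound D → FoundSound found D →
                   decide k n W C found D qs ≡ true → ⊥
    decide-sound k n W C found D [] cover cover⁺ ab fs h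
      with ∨-true {(2 ≤ᵇ n) ∧ graphRefutes (isZero k) W (dropExcluded D C)} h
    ... | inj₁ g = graphRefutes-sound (isZero k) n W _ cover (dropExcluded-cover n D C ab cover⁺) (proj₂ (∧-true {2 ≤ᵇ n} g))
    ... | inj₂ g = next-sound k (suc n) _ found D (dropExcluded-cover n D C ab cover⁺) ab fs g
    decide-sound k n W C found D (q ∷ qs) cover cover⁺ ab fs h with if-true (isUnknown (statusOf D q)) h
    ... | inj₂ (_ , h′) = decide-sound k n W C found D qs cover cover⁺ ab fs h′
    ... | inj₁ (unk , h′) with ∧-true {decide k n W C found (setStatus D q absent) qs} h′ | isUnknown-true (statusOf D q) unk
    ...   | h-absent , h-present | unk′ with q ∈? L
    ...     | no q∉L = decide-sound k n W C found (setStatus D q absent) qs cover cover⁺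
                         (AbsentSound-absent D q q∉L ab) (FoundSound-absent D q found unk′ fs) h-absent
    ...     | yes q∈L with if-true (bound ≤ᵇ length found) h-present
    ...       | inj₁ (full , _) = full-impossible q found D q∈L unk′ fs full
    ...       | inj₂ (_ , h″)   = decide-sound k n W C (q ∷ found) (setStatus D q present) qs cover cover⁺
                                    (AbsentSound-present D q ab) (FoundSound-present D q found unk′ q∈L fs) h″

    next-sound : ∀ k n W found D → CandidatesCover n W → AbsentSound D → FoundSound found D → next k n W found D ≡ true → ⊥
    next-sound (suc k) n W found D cover ab fs h = level-sound k n W found D cover ab fs h

  search-sound : ∀ depth → search depth ≡ true → ⊥
  search-sound depth = level-sound depth 0 (candidate [] ([] ∷ []) ∷ []) [] leaf (λ _ → here refl)
    (λ q abs → ⊥-elim (unknown≢absent (trans (sym (statusOf-leaf q)) abs))) ([] , [] , [])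
    where
    unknown≢absent : unknown ≢ absent
    unknown≢absent ()

search-lower-bound : ∀ bound depth → Search.search bound depth ≡ true →
                     ∀ ω → ClosedUnderReversal ω → PalAtLeast (suc bound) ω
search-lower-bound bound depth refuted ω closed L covers with suc bound ≤? length L
... | yes enough = enough
... | no  few    = ⊥-elim (Soundness.search-sound bound closed L covers (≤-pred (≰⇒> few)) depth refuted)

-- A closed aperiodic word with 13 palindromic factors

-- Out of range the result is junk (the letter a); it is only used below the length.
letterAt : List Letter → ℕ → Letter
letterAt []       _       = a
letterAt (x ∷ xs) zero    = x
letterAt (x ∷ xs) (suc i) = letterAt xs i

letterAt-++ : ∀ xs ys i → i < length xs → letterAt (xs ++ ys) i ≡ letterAt xs i
letterAt-++ (x ∷ xs) ys zero    _         = refl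
letterAt-++ (x ∷ xs) ys (suc i) (s≤s i<n) = letterAt-++ xs ys i i<n

letterAt-length : ∀ p x s → letterAt (p ++ x ∷ s) (length p) ≡ x
letterAt-length []      x s = refl
letterAt-length (y ∷ p) x s = letterAt-length p x s

length-<-++-∷ : ∀ (p : List Letter) x s → length p < length (p ++ x ∷ s)
length-<-++-∷ []      x s = s≤s z≤n
length-<-++-∷ (y ∷ p) x s = s≤s (length-<-++-∷ p x s)

module Limit (u : ℕ → List Letter) (grows : ∀ n → IsPrefix (u n) (u (suc n))) (long : ∀ n → n < length (u n)) where

  limit : Word
  limit i = letterAt (u i) i

  u-prefix : ∀ n d → IsPrefix (u n) (u (d + n))
  u-prefix n zero    = [] , sym (++-identityʳ (u n))
  u-prefix n (suc d) with u-prefix n d | grows (d + n)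
  ... | r , e | r′ , e′ = r ++ r′ , trans e′ (trans (cong (_++ r′) e) (++-assoc (u n) r r′))

  limit-letterAt : ∀ n i → i < length (u n) → limit i ≡ letterAt (u n) i
  limit-letterAt n i i<n with u-prefix i n | u-prefix n i
  ... | r , e | r′ , e′ = begin
    letterAt (u i) i               ≡⟨ sym (letterAt-++ (u i) r i (long i)) ⟩
    letterAt (u i ++ r) i          ≡⟨ cong (λ w → letterAt w i) (sym e) ⟩
    letterAt (u (n + i)) i         ≡⟨ cong (λ k → letterAt (u k) i) (+-comm n i) ⟩
    letterAt (u (i + n)) i         ≡⟨ cong (λ w → letterAt w i) e′ ⟩
    letterAt (u n ++ r′) i         ≡⟨ letterAt-++ (u n) r′ i i<n ⟩
    letterAt (u n) i               ∎
    where open ≡-Reasoning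

  infix-slice : ∀ n p v s → u n ≡ p ++ v ++ s → slice limit (length p) (length v) ≡ v
  infix-slice n p []      s e = refl
  infix-slice n p (x ∷ v) s e = cong₂ _∷_ first rest
    where
    first : limit (length p) ≡ x
    first = trans (limit-letterAt n (length p) (subst (λ w → length p < length w) (sym e) (length-<-++-∷ p x (v ++ s))))
                  (trans (cong (λ w → letterAt w (length p)) e) (letterAt-length p x (v ++ s)))
    rest : slice limit (suc (length p)) (length v) ≡ v
    rest = subst (λ k → slice limit k (length v) ≡ v) (trans (length-++ p) (+-comm (length p) 1))
             (infix-slice n (p ++ x ∷ []) v s (trans e (sym (++-assoc p (x ∷ []) (v ++ s)))))

  infix⇒factor : ∀ n v → Infix v (u n) → Factor v limit
  infix⇒factor n v (p , s , e) = length p , infix-slice n p v s e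

  factor⇒infix : ∀ v → Factor v limit → ∃ λ n → Infix v (u n)
  factor⇒infix v (i , e) = n , p , s , trans split (cong (λ w → p ++ w ++ s) middle)
    where
    open ≡-Reasoning
    k = length v
    n = i + k
    p = take i (u n)
    m = take k (drop i (u n))
    s = drop k (drop i (u n))
    split : u n ≡ p ++ m ++ s
    split = begin
      u n                  ≡⟨ sym (take++drop≡id i (u n)) ⟩
      p ++ drop i (u n)    ≡⟨ cong (p ++_) (sym (take++drop≡id k (drop i (u n)))) ⟩
      p ++ m ++ s          ∎
    i+k≤u : i + k ≤ length (u n)
    i+k≤u = ≤-trans (n≤1+n (i + k)) (long n)
    length-p : length p ≡ i
    length-p = trans (length-take i (u n)) (m≤n⇒m⊓n≡m (≤-trans (m≤m+n i k) i+k≤u))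
    k≤rest : k ≤ length (drop i (u n))
    k≤rest = subst (k ≤_) (sym (length-drop i (u n))) (subst (_≤ length (u n) ∸ i) (m+n∸m≡n i k) (∸-monoˡ-≤ i i+k≤u))
    length-m : length m ≡ k
    length-m = trans (length-take k (drop i (u n))) (m≤n⇒m⊓n≡m k≤rest)
    middle : m ≡ v
    middle = begin
      m                                 ≡⟨ sym (infix-slice n p m s split) ⟩
      slice limit (length p) (length m) ≡⟨ cong₂ (slice limit) length-p length-m ⟩
      slice limit i k                   ≡⟨ e ⟩
      v                                 ∎

module Mirror (w₀ c : List Letter) (w₀-nonempty : 1 ≤ length w₀) where

  approx : ℕ → List Letter
  approx zero    = w₀
  approx (suc n) = approx n ++ c ++ reverse (approx n)

  approx-grows : ∀ n → IsPrefix (approx n) (approx (suc n))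
  approx-grows n = c ++ reverse (approx n) , refl

  approx-long : ∀ n → n < length (approx n)
  approx-long zero    = w₀-nonempty
  approx-long (suc n) = ≤-trans (s≤s (approx-long n))
    (subst (length (approx n) <_) (sym (length-++ (approx n))) (m<m+n (length (approx n)) mirror-nonempty))
    where
    mirror-nonempty : 0 < length (c ++ reverse (approx n))
    mirror-nonempty = ≤-trans (≤-trans (s≤s z≤n) (approx-long n))
      (≤-trans (≤-reflexive (sym (length-reverse (approx n)))) (length-++-≤ʳ (reverse (approx n)) {c}))

  open Limit approx approx-grows approx-long public

  approx-reverse : ∀ n v → Infix v (approx n) → Infix (reverse v) (approx (suc n))
  approx-reverse n v occ =
    infix-++ˡ (approx n) _ _ (infix-++ˡ c _ _ (reverse-infix v (approx n) occ))

  closed : ClosedUnderReversal limit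
  closed v occurs with factor⇒infix v occurs
  ... | n , v∈ = infix⇒factor (suc n) (reverse v) (approx-reverse n v v∈)

w₀ c : List Letter
w₀ = a ∷ b ∷ b ∷ a ∷ b ∷ a ∷ a ∷ a ∷ b ∷ b ∷ []
c  = a ∷ a ∷ b ∷ a ∷ []

open Mirror w₀ c (s≤s z≤n) renaming (limit to ω₀; closed to ω₀-closed)

factors₈ : List (List Letter)
factors₈ =
  (a ∷ a ∷ a ∷ b ∷ a ∷ a ∷ b ∷ b ∷ []) ∷ (a ∷ a ∷ a ∷ b ∷ a ∷ b ∷ b ∷ a ∷ []) ∷
  (a ∷ a ∷ a ∷ b ∷ b ∷ a ∷ a ∷ b ∷ []) ∷ (a ∷ a ∷ a ∷ b ∷ b ∷ a ∷ b ∷ a ∷ []) ∷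
  (a ∷ a ∷ b ∷ a ∷ a ∷ a ∷ b ∷ b ∷ []) ∷ (a ∷ a ∷ b ∷ a ∷ a ∷ b ∷ b ∷ a ∷ []) ∷
  (a ∷ a ∷ b ∷ a ∷ b ∷ b ∷ a ∷ a ∷ []) ∷ (a ∷ a ∷ b ∷ b ∷ a ∷ a ∷ a ∷ b ∷ []) ∷
  (a ∷ a ∷ b ∷ b ∷ a ∷ a ∷ b ∷ a ∷ []) ∷ (a ∷ a ∷ b ∷ b ∷ a ∷ b ∷ a ∷ a ∷ []) ∷
  (a ∷ b ∷ a ∷ a ∷ a ∷ b ∷ b ∷ a ∷ []) ∷ (a ∷ b ∷ a ∷ a ∷ b ∷ b ∷ a ∷ a ∷ []) ∷
  (a ∷ b ∷ a ∷ a ∷ b ∷ b ∷ a ∷ b ∷ []) ∷ (a ∷ b ∷ a ∷ b ∷ b ∷ a ∷ a ∷ a ∷ []) ∷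
  (a ∷ b ∷ a ∷ b ∷ b ∷ a ∷ a ∷ b ∷ []) ∷ (a ∷ b ∷ b ∷ a ∷ a ∷ a ∷ b ∷ a ∷ []) ∷
  (a ∷ b ∷ b ∷ a ∷ a ∷ b ∷ a ∷ a ∷ []) ∷ (a ∷ b ∷ b ∷ a ∷ a ∷ b ∷ a ∷ b ∷ []) ∷
  (a ∷ b ∷ b ∷ a ∷ b ∷ a ∷ a ∷ a ∷ []) ∷ (a ∷ b ∷ b ∷ a ∷ b ∷ a ∷ a ∷ b ∷ []) ∷
  (b ∷ a ∷ a ∷ a ∷ b ∷ a ∷ a ∷ b ∷ []) ∷ (b ∷ a ∷ a ∷ a ∷ b ∷ a ∷ b ∷ b ∷ []) ∷
  (b ∷ a ∷ a ∷ a ∷ b ∷ b ∷ a ∷ a ∷ []) ∷ (b ∷ a ∷ a ∷ a ∷ b ∷ b ∷ a ∷ b ∷ []) ∷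
  (b ∷ a ∷ a ∷ b ∷ a ∷ a ∷ a ∷ b ∷ []) ∷ (b ∷ a ∷ a ∷ b ∷ a ∷ b ∷ b ∷ a ∷ []) ∷
  (b ∷ a ∷ a ∷ b ∷ b ∷ a ∷ a ∷ a ∷ []) ∷ (b ∷ a ∷ a ∷ b ∷ b ∷ a ∷ b ∷ a ∷ []) ∷
  (b ∷ a ∷ b ∷ a ∷ a ∷ a ∷ b ∷ b ∷ []) ∷ (b ∷ a ∷ b ∷ a ∷ a ∷ b ∷ b ∷ a ∷ []) ∷
  (b ∷ a ∷ b ∷ b ∷ a ∷ a ∷ a ∷ b ∷ []) ∷ (b ∷ a ∷ b ∷ b ∷ a ∷ a ∷ b ∷ a ∷ []) ∷
  (b ∷ b ∷ a ∷ a ∷ a ∷ b ∷ a ∷ a ∷ []) ∷ (b ∷ b ∷ a ∷ a ∷ a ∷ b ∷ a ∷ b ∷ []) ∷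
  (b ∷ b ∷ a ∷ a ∷ b ∷ a ∷ a ∷ a ∷ []) ∷ (b ∷ b ∷ a ∷ a ∷ b ∷ a ∷ b ∷ b ∷ []) ∷
  (b ∷ b ∷ a ∷ b ∷ a ∷ a ∷ a ∷ b ∷ []) ∷ (b ∷ b ∷ a ∷ b ∷ a ∷ a ∷ b ∷ b ∷ []) ∷ []

palindromes₀ : List (List Letter)
palindromes₀ =
  [] ∷ (a ∷ []) ∷ (b ∷ []) ∷ (a ∷ a ∷ []) ∷ (b ∷ b ∷ []) ∷ (a ∷ a ∷ a ∷ []) ∷ (a ∷ b ∷ a ∷ []) ∷
  (b ∷ a ∷ b ∷ []) ∷ (a ∷ b ∷ b ∷ a ∷ []) ∷ (b ∷ a ∷ a ∷ b ∷ []) ∷ (a ∷ a ∷ b ∷ a ∷ a ∷ []) ∷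
  (b ∷ a ∷ a ∷ a ∷ b ∷ []) ∷ (a ∷ a ∷ b ∷ b ∷ a ∷ a ∷ []) ∷ []

factors₈-reverse : All (λ u → reverse u ∈ factors₈) factors₈
factors₈-reverse = from-yes (all? (λ u → reverse u ∈? factors₈) factors₈)

factors₈-palindromic-prefixes : All (λ u → All (λ v → Palindrome v → v ∈ palindromes₀) (inits u)) factors₈
factors₈-palindromic-prefixes =
  from-yes (all? (λ u → all? (λ v → (reverse v ≟ʷ v) →-dec (v ∈? palindromes₀)) (inits u)) factors₈)

palindromes₀-short : All (λ w → length w ≤ 6) palindromes₀
palindromes₀-short = from-yes (all? (λ w → length w ≤? 6) palindromes₀)

palindromes₀-unique : Unique palindromes₀
palindromes₀-unique = from-yes (unique? palindromes₀)

AllFactors₈-check : ∀ xs → {_ : True (all? (λ v → (length v ≟ 8) →-dec (v ∈? factors₈)) (windows 8 xs))} →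
                    AllFactors (_∈ factors₈) 8 xs
AllFactors₈-check xs {ok} = AllFactors-windows 7 xs (toWitness ok)

approx-starts : ∀ n → IsPrefix w₀ (approx n)
approx-starts zero = [] , sym (++-identityʳ w₀)
approx-starts (suc n) with approx-starts n
... | r , e = r ++ c ++ reverse (approx n) , trans (cong (_++ c ++ reverse (approx n)) e) (++-assoc w₀ r _)

approx-ends : ∀ n → IsSuffix (reverse w₀) (approx (suc n))
approx-ends n with approx-starts n
... | r , e = approx n ++ c ++ reverse r , (begin
  approx n ++ c ++ reverse (approx n)        ≡⟨ cong (λ v → approx n ++ c ++ reverse v) e ⟩
  approx n ++ c ++ reverse (w₀ ++ r)         ≡⟨ cong (λ v → approx n ++ c ++ v) (reverse-++ w₀ r) ⟩
  approx n ++ c ++ reverse r ++ reverse w₀   ≡⟨ cong (approx n ++_) (sym (++-assoc c (reverse r) (reverse w₀))) ⟩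
  approx n ++ (c ++ reverse r) ++ reverse w₀ ≡⟨ sym (++-assoc (approx n) _ (reverse w₀)) ⟩
  (approx n ++ c ++ reverse r) ++ reverse w₀ ∎)
  where open ≡-Reasoning

approx-factors₈ : ∀ n → AllFactors (_∈ factors₈) 8 (approx n)
approx-factors₈ zero          = AllFactors₈-check w₀
approx-factors₈ (suc zero)    = AllFactors₈-check (approx 1)
approx-factors₈ (suc (suc n)) =
  subst (λ X → AllFactors (_∈ factors₈) 8 (X ++ c ++ reverse X)) (sym e)
    (AllFactors-extend (λ u → All.lookup factors₈-reverse) c P (reverse w₀) c<8 8≤10
      (subst (AllFactors (_∈ factors₈) 8) e (approx-factors₈ (suc n)))
      (AllFactors₈-check (reverse w₀ ++ c ++ reverse (reverse w₀))))
  where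
  P = proj₁ (approx-ends n)
  e = proj₂ (approx-ends n)
  c<8 : length c < 8
  c<8 = s≤s (s≤s (s≤s (s≤s (s≤s z≤n))))
  8≤10 : 8 ≤ length (reverse w₀)
  8≤10 = m≤m+n 8 2

ω₀-factors₈ : ∀ v → Factor v ω₀ → length v ≡ 8 → v ∈ factors₈
ω₀-factors₈ v occ len with factor⇒infix v occ
... | n , occ′ = approx-factors₈ n v len occ′

short-palindromes : ∀ w → PalFactor ω₀ w → length w ≤ 8 → w ∈ palindromes₀
short-palindromes w ((i , occ) , pal) w≤8 =
  All.lookup (All.lookup factors₈-palindromic-prefixes (ω₀-factors₈ u (slice-factor ω₀ i 8) (length-slice ω₀ i 8)))
             (prefix∈inits w u (rest , w-prefix)) pal
  where
  u = slice ω₀ i 8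
  rest = slice ω₀ (i + length w) (8 ∸ length w)
  open ≡-Reasoning
  w-prefix : u ≡ w ++ rest
  w-prefix = begin
    slice ω₀ i 8                            ≡⟨ cong (slice ω₀ i) (sym (m+[n∸m]≡n w≤8)) ⟩
    slice ω₀ i (length w + (8 ∸ length w))  ≡⟨ slice-++ ω₀ i (length w) (8 ∸ length w) ⟩
    slice ω₀ i (length w) ++ rest           ≡⟨ cong (_++ rest) occ ⟩
    w ++ rest                               ∎

ω₀-palindromes-short : ∀ w → PalFactor ω₀ w → length w ≤ 6
ω₀-palindromes-short =
  palindrome-length-bound 6 (λ w pal w≤8 → All.lookup palindromes₀-short (short-palindromes w pal w≤8))

palindromes₀-occur : All (PalFactor ω₀) palindromes₀
palindromes₀-occur =
  ((0 , refl) , refl) ∷ ((0 , refl) , refl) ∷ ((1 , refl) , refl) ∷ ((5 , refl) , refl) ∷ ((1 , refl) , refl) ∷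
  ((5 , refl) , refl) ∷ ((3 , refl) , refl) ∷ ((2 , refl) , refl) ∷ ((0 , refl) , refl) ∷ ((9 , refl) , refl) ∷
  ((24 , refl) , refl) ∷ ((4 , refl) , refl) ∷ ((6 , refl) , refl) ∷ []

ω₀-palindromes : PalExactly 13 ω₀
ω₀-palindromes = palindromes₀ , refl , palindromes₀-unique , λ w →
  (λ pal → short-palindromes w pal (≤-trans (ω₀-palindromes-short w pal) (m≤m+n 6 2))) ,
  All.lookup palindromes₀-occur

ω₀-aperiodic : Aperiodic ω₀
ω₀-aperiodic = bounded-palindromes⇒aperiodic 6 ω₀-closed ω₀-palindromes-short

-- The type checker runs the whole search here.
search-refutes : Search.search 12 11 ≡ true
search-refutes = refl

closed-lower-bound : ∀ ω → Cl ω → PalAtLeast 13 ω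
closed-lower-bound = search-lower-bound 12 11 search-refutes

mainTheorem10 : MinPalIs Cl 13 × MinPalIs ApCl 13
mainTheorem10 =
  (closed-lower-bound , ω₀ , ω₀-closed , ω₀-palindromes) ,
  ((λ ω ap-cl → closed-lower-bound ω (proj₂ ap-cl)) , ω₀ , (ω₀-aperiodic , ω₀-closed) , ω₀-palindromes)
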